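{- A tournament $T$ on the vertices $\{1,2,\dots,n\}$ is semiacyclic if and only if $T$ contains none of the following directed cycles, for any $a<b<c<d$ in $\{1,\dots,n\}$ (respectively $a<b<c$ for $C_0$): $C_0=(a,b,c)$, $C_1=(a,c,b,d)$, $C_2=(a,d,b,c)$, $C_3=(a,b,d,c)$, $C_4=(a,c,d,b)$.
   Context: A tournament on $\{1,\dots,n\}$ is a loopless directed graph $T$ such that for every $i\ne j$ exactly one of $(i,j)$, $(j,i)$ is in $T$. The notation $(c_1,\dots,c_m)$ denotes the directed cycle with edges $(c_1,c_2),(c_2,c_3),\dots,(c_m,c_1)$; with $c_0:=c_m$, index $i$ is an ascent if $c_{i-1}<c_i$ and a descent if $c_{i-1}>c_i$. A directed cycle is ascending if its number of ascents is at least its number of descents, and a tournament is semiacyclic if it contains no ascending directed cycle. -}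

module Defs where

open import Data.Nat using (ℕ; _≤_)
open import Data.Fin using (Fin; _<_; _<?_)
open import Data.List using (List; []; _∷_; _++_; [_]; zip; length; filter)
open import Data.List.Relation.Unary.All using (All)
open import Data.List.Relation.Unary.Unique.Propositional using (Unique)
open import Data.Product using (_×_; _,_; Σ; ∃; proj₁; proj₂)
open import Data.Sum using (_⊎_)
open import Relation.Binary.PropositionalEquality using (_≡_; _≢_)
open import Relation.Nullary using (¬_)
open import Function.Base using (_∘_)

-- A tournament on the vertex set Fin n (vertex i ∈ Fin n stands for i+1 ∈ {1,…,n};
-- the order is preserved, so ascents/descents are unchanged).
record Tournament (n : ℕ) : Set₁ where
  field
    Edge     : Fin n → Fin n → Set
    loopless : ∀ i → ¬ Edge i i
    total    : ∀ i j → i ≢ j → Edge i j ⊎ Edge j i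
    asym     : ∀ i j → Edge i j → ¬ Edge j i
open Tournament public

-- consecutive pairs of the cycle (c₁,…,c_m) including the closing pair (c_m, c₁):
-- these are exactly the edges (c_{i-1}, c_i) with c₀ := c_m.
cyclicPairs : ∀ {n} → List (Fin n) → List (Fin n × Fin n)
cyclicPairs []       = []
cyclicPairs (x ∷ xs) = zip (x ∷ xs) (xs ++ [ x ])

IsDirectedCycle : ∀ {n} → Tournament n → List (Fin n) → Set
IsDirectedCycle T cs =
  (3 ≤ length cs) × Unique cs × All (λ p → Edge T (proj₁ p) (proj₂ p)) (cyclicPairs cs)

ascents : ∀ {n} → List (Fin n) → ℕ
ascents cs = length (filter (λ p → proj₁ p <? proj₂ p) (cyclicPairs cs))

descents : ∀ {n} → List (Fin n) → ℕ
descents cs = length (filter (λ p → proj₂ p <? proj₁ p) (cyclicPairs cs))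

Ascending : ∀ {n} → List (Fin n) → Set
Ascending cs = descents cs ≤ ascents cs

Semiacyclic : ∀ {n} → Tournament n → Set
Semiacyclic T = ¬ (∃ λ cs → IsDirectedCycle T cs × Ascending cs)

-- Give an edge (x, y) of a directed cycle the sign +1 if x < y and -1 otherwise, and call the sum
-- of the signs the weight of the cycle: the cycle is ascending iff its weight is nonnegative.
-- C₀ has weight 1 and C₁, ..., C₄ have weight 0, which gives one direction. For the other, take a
-- shortest directed cycle of nonnegative weight. A chord {x, y} splits it into two shorter cycles,
-- one through each arc between x and y, and the orientation of the chord decides which of them is
-- directed; as their weights add up to the weight of the whole cycle and the directed one has
-- negative weight, the weight of one side never lies between 0 and the total. If the weight is
-- positive, two consecutive edges ascend, x < y < z (the sums of neighbouring signs add up to twice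
-- the weight), and the chord {x, z} leaves only the case that the cycle is the triangle C₀. A
-- triangle has odd weight, and a quadrilateral of weight 0 read from its minimum is one of
-- C₁, ..., C₄. A longer cycle of weight 0 has four consecutive signs a, b, ¬b, ¬a, and the two
-- chords spanning three of these edges then order four vertices cyclically.

module Submission where

open import Defs
open import Data.Bool using (Bool; true; false; not)
open import Data.Bool.Properties using (_≟_; ¬-not; not-¬)
open import Data.Empty using (⊥; ⊥-elim)
open import Data.Fin using (Fin; _<_; _≤_; _<?_)
import Data.Fin.Properties as Fin
open import Data.Integer using (ℤ; 0ℤ; 1ℤ; -1ℤ; _+_; _*_; -_; +≤+; +<+)
import Data.Integer as ℤ using (+_; _≤_; _<_; _<?_)
import Data.Integer.Properties as ℤ
open import Algebra.Properties.AbelianGroup ℤ.+-0-abelianGroup using (∙-cancelˡ)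
open import Data.Integer.Tactic.RingSolver using (solve-∀)
open import Data.List using (List; []; _∷_; _++_; [_]; length; map; head; zip; filter)
import Data.List.Properties as List
open import Data.List.Membership.Propositional.Properties using (∈-++⁺ʳ; ∈-∃++)
open import Data.List.Relation.Binary.Sublist.Propositional using (_⊆_; []; _∷_; _∷ʳ_; ⊆-refl)
open import Data.List.Relation.Binary.Sublist.Propositional.Properties using (All-resp-⊆; ++⁺; ++⁺ˡ; ++⁺ʳ)
open import Data.List.Relation.Unary.All as All using (All; []; _∷_)
import Data.List.Relation.Unary.All.Properties as All
open import Data.List.Relation.Unary.Any using (here; there)
import Data.List.Relation.Unary.AllPairs.Properties as AllPairs
open import Data.List.Relation.Unary.Unique.Propositional using (Unique; []; _∷_)
open import Data.Maybe using (fromMaybe)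
open import Data.Nat as ℕ using (ℕ; zero; suc; z≤n; s≤s)
import Data.Nat.Properties as ℕ
open import Data.Nat.DivMod using (_%_; _/_; m≡m%n+[m/n]*n; m%n<n)
open import Data.Product using (_×_; _,_; ∃; proj₁; proj₂)
open import Data.Sum using ([_,_]′)
open import Function.Base using (_∘_; id)
open import Function.Bundles using (_⇔_; mk⇔; Equivalence)
open import Relation.Binary.Definitions using (tri<; tri≈; tri>)
open import Relation.Binary.PropositionalEquality hiding ([_])
open import Relation.Nullary using (¬_; Dec; yes; no; does; ¬?)
open import Relation.Nullary.Decidable using (_×-dec_; dec-true; dec-false; decidable-stable)

private variable
  n : ℕ
  A B : Set

-- Periodic sequences and their sums

Periodic : ℕ → (ℕ → A) → Set
Periodic m f = ∀ k → f (k ℕ.+ m) ≡ f k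

periodic-+* : ∀ {m} {f : ℕ → A} → Periodic m f → ∀ j q → f (j ℕ.+ q ℕ.* m) ≡ f j
periodic-+* {f = f} per j zero = cong f (ℕ.+-identityʳ j)
periodic-+* {m = m} {f} per j (suc q) = begin
  f (j ℕ.+ (m ℕ.+ q ℕ.* m))  ≡⟨ cong f (swap-last j m (q ℕ.* m)) ⟩
  f (j ℕ.+ q ℕ.* m ℕ.+ m)    ≡⟨ per (j ℕ.+ q ℕ.* m) ⟩
  f (j ℕ.+ q ℕ.* m)          ≡⟨ periodic-+* per j q ⟩
  f j                        ∎
  where
  open ≡-Reasoning
  swap-last : ∀ a b c → a ℕ.+ (b ℕ.+ c) ≡ a ℕ.+ c ℕ.+ b
  swap-last a b c = trans (cong (a ℕ.+_) (ℕ.+-comm b c)) (sym (ℕ.+-assoc a c b))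

periodic-all : ∀ {m} {f : ℕ → A} {P : A → Set} .{{_ : ℕ.NonZero m}} → Periodic m f →
               (∀ k → k ℕ.< m → P (f k)) → ∀ k → P (f k)
periodic-all {m = m} {f} {P} per below k =
  subst P (sym (trans (cong f (m≡m%n+[m/n]*n k m)) (periodic-+* per (k % m) (k / m))))
    (below (k % m) (m%n<n k m))

infix 8 ±_
±_ : Bool → ℤ
± true  = 1ℤ
± false = -1ℤ

±-not : ∀ b → ± not b ≡ - ± b
±-not true  = refl
±-not false = refl

sumUpTo : ℕ → (ℕ → ℤ) → ℤ
sumUpTo zero    f = 0ℤ
sumUpTo (suc m) f = f 0 + sumUpTo m (f ∘ suc)

sumUpTo-cong : ∀ m {f g : ℕ → ℤ} → (∀ k → f k ≡ g k) → sumUpTo m f ≡ sumUpTo m g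
sumUpTo-cong zero    f≗g = refl
sumUpTo-cong (suc m) f≗g = cong₂ _+_ (f≗g 0) (sumUpTo-cong m (f≗g ∘ suc))

sumUpTo-+ : ∀ m (f g : ℕ → ℤ) → sumUpTo m (λ k → f k + g k) ≡ sumUpTo m f + sumUpTo m g
sumUpTo-+ zero    f g = refl
sumUpTo-+ (suc m) f g =
  trans (cong ((f 0 + g 0) +_) (sumUpTo-+ m (f ∘ suc) (g ∘ suc)))
        (interchange (f 0) (g 0) (sumUpTo m (f ∘ suc)) (sumUpTo m (g ∘ suc)))
  where
  interchange : ∀ a b x y → (a + b) + (x + y) ≡ (a + x) + (b + y)
  interchange = solve-∀

sumUpTo-*ˡ : ∀ m c (f : ℕ → ℤ) → sumUpTo m (λ k → c * f k) ≡ c * sumUpTo m f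
sumUpTo-*ˡ zero    c f = sym (ℤ.*-zeroʳ c)
sumUpTo-*ˡ (suc m) c f =
  trans (cong (c * f 0 +_) (sumUpTo-*ˡ m c (f ∘ suc))) (sym (ℤ.*-distribˡ-+ c (f 0) _))

sumUpTo-last : ∀ m (f : ℕ → ℤ) → sumUpTo (suc m) f ≡ sumUpTo m f + f m
sumUpTo-last zero    f = ℤ.+-comm (f 0) 0ℤ
sumUpTo-last (suc m) f =
  trans (cong (f 0 +_) (sumUpTo-last m (f ∘ suc))) (sym (ℤ.+-assoc (f 0) _ (f (suc m))))

sumUpTo-shift : ∀ {m} {f : ℕ → ℤ} → Periodic m f → sumUpTo m (f ∘ suc) ≡ sumUpTo m f
sumUpTo-shift {m} {f} per = ∙-cancelˡ (f 0) _ _ (begin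
  f 0 + sumUpTo m (f ∘ suc)  ≡⟨ sumUpTo-last m f ⟩
  sumUpTo m f + f m          ≡⟨ cong (sumUpTo m f +_) (per 0) ⟩
  sumUpTo m f + f 0          ≡⟨ ℤ.+-comm (sumUpTo m f) (f 0) ⟩
  f 0 + sumUpTo m f          ∎)
  where open ≡-Reasoning

sumUpTo-shiftBy : ∀ {m} {f : ℕ → ℤ} → Periodic m f → ∀ p → sumUpTo m (λ k → f (k ℕ.+ p)) ≡ sumUpTo m f
sumUpTo-shiftBy {m} {f} per zero    = sumUpTo-cong m (cong f ∘ ℕ.+-identityʳ)
sumUpTo-shiftBy {m} {f} per (suc p) = begin
  sumUpTo m (λ k → f (k ℕ.+ suc p))    ≡⟨ sumUpTo-cong m (cong f ∘ λ k → ℕ.+-suc k p) ⟩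
  sumUpTo m (λ k → f (suc (k ℕ.+ p)))  ≡⟨ sumUpTo-shiftBy (per ∘ suc) p ⟩
  sumUpTo m (f ∘ suc)                  ≡⟨ sumUpTo-shift per ⟩
  sumUpTo m f                          ∎
  where open ≡-Reasoning

sumUpTo-nonneg : ∀ m {f : ℕ → ℤ} → (∀ k → 0ℤ ℤ.≤ f k) → 0ℤ ℤ.≤ sumUpTo m f
sumUpTo-nonneg zero    f≥0 = +≤+ z≤n
sumUpTo-nonneg (suc m) f≥0 = ℤ.+-mono-≤ (f≥0 0) (sumUpTo-nonneg m (f≥0 ∘ suc))

sumUpTo-pos : ∀ m {f : ℕ → ℤ} → (∀ k → 0ℤ ℤ.≤ f k) → 0ℤ ℤ.< f 0 → 0ℤ ℤ.< sumUpTo (suc m) f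
sumUpTo-pos m f≥0 f₀>0 = ℤ.+-mono-<-≤ f₀>0 (sumUpTo-nonneg m (f≥0 ∘ suc))

sumUpTo-pos⇒∃ : ∀ m (f : ℕ → ℤ) → 0ℤ ℤ.< sumUpTo m f → ∃ λ k → 0ℤ ℤ.< f k
sumUpTo-pos⇒∃ zero    f (+<+ ())
sumUpTo-pos⇒∃ (suc m) f Σ>0 with 0ℤ ℤ.<? f 0
... | yes f₀>0 = 0 , f₀>0
... | no  f₀≯0 =
  let k , fk>0 = sumUpTo-pos⇒∃ m (f ∘ suc) (ℤ.<-≤-trans Σ>0 drop-f₀)
  in suc k , fk>0
  where
  drop-f₀ : f 0 + sumUpTo m (f ∘ suc) ℤ.≤ sumUpTo m (f ∘ suc)
  drop-f₀ = ℤ.≤-trans (ℤ.+-monoˡ-≤ _ (ℤ.≮⇒≥ f₀≯0)) (ℤ.≤-reflexive (ℤ.+-identityˡ _))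

positive-pair-true : ∀ a b → 0ℤ ℤ.< ± a + ± b → a ≡ true × b ≡ true
positive-pair-true true  true  _          = refl , refl
positive-pair-true true  false (+<+ ())
positive-pair-true false true  (+<+ ())
positive-pair-true false false ()

sumUpTo-pairs : ∀ {m} {s : ℕ → Bool} → Periodic m s →
                sumUpTo m (λ k → ± s k + ± s (suc k)) ≡ sumUpTo m (±_ ∘ s) + sumUpTo m (±_ ∘ s)
sumUpTo-pairs {m} {s} per =
  trans (sumUpTo-+ m (±_ ∘ s) (±_ ∘ s ∘ suc))
        (cong (sumUpTo m (±_ ∘ s) +_) (sumUpTo-shift (cong ±_ ∘ per)))

consecutive-trues : ∀ {m} {s : ℕ → Bool} → Periodic m s → 0ℤ ℤ.< sumUpTo m (±_ ∘ s) →
                    ∃ λ k → s k ≡ true × s (suc k) ≡ true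
consecutive-trues {m} {s} per Σ>0 =
  let k , pair>0 = sumUpTo-pos⇒∃ m _ (subst (0ℤ ℤ.<_) (sym (sumUpTo-pairs per)) (ℤ.+-mono-< Σ>0 Σ>0))
  in k , positive-pair-true (s k) (s (suc k)) pair>0

window : (ℕ → A) → ℕ → A × A × A × A
window s k = s k , s (suc k) , s (suc (suc k)) , s (suc (suc (suc k)))

window-periodic : ∀ {m} {s : ℕ → A} → Periodic m s → Periodic m (window s)
window-periodic per k =
  cong₂ _,_ (per k) (cong₂ _,_ (per (suc k)) (cong₂ _,_ (per (suc (suc k))) (per (suc (suc (suc k))))))

AntiPalindrome : Bool × Bool × Bool × Bool → Set
AntiPalindrome (a , b , c , d) = b ≢ c × a ≢ d

AntiPalindromeFree : (ℕ → Bool) → Set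
AntiPalindromeFree s = ∀ k → ¬ AntiPalindrome (window s k)

antiPalindrome? : ∀ w → Dec (AntiPalindrome w)
antiPalindrome? (a , b , c , d) = ¬? (b ≟ c) ×-dec ¬? (a ≟ d)

alternating-antiPalindrome : ∀ {a b c d} → a ≢ b → b ≢ c → c ≢ d → AntiPalindrome (a , b , c , d)
alternating-antiPalindrome a≢b b≢c c≢d = b≢c , λ a≡d → c≢d (trans (sym a≡c) a≡d)
  where a≡c = trans (¬-not a≢b) (sym (¬-not (≢-sym b≢c)))

¬antiPalindrome-outer : ∀ {a b c d} → ¬ AntiPalindrome (a , b , c , d) → b ≢ c → a ≡ d
¬antiPalindrome-outer {a} {d = d} no-ap b≢c = decidable-stable (a ≟ d) (λ a≢d → no-ap (b≢c , a≢d))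

equal-neighbours : ∀ (s : ℕ → Bool) → ¬ AntiPalindrome (window s 0) → ∃ λ p → s p ≡ s (suc p)
equal-neighbours s no-ap with s 0 ≟ s 1 | s 1 ≟ s 2 | s 2 ≟ s 3
... | yes e  | _      | _      = 0 , e
... | no _   | yes e  | _      = 1 , e
... | no _   | no _   | yes e  = 2 , e
... | no s₀₁ | no s₁₂ | no s₂₃ = ⊥-elim (no-ap (alternating-antiPalindrome s₀₁ s₁₂ s₂₃))

≡-not⇒≢ : ∀ {x y b} → x ≡ b → y ≡ not b → x ≢ y
≡-not⇒≢ refl refl = not-¬ refl

lone-opposite : ∀ (t : ℕ → Bool) {b} → AntiPalindromeFree t → t 0 ≡ b → t 1 ≡ b → t 2 ≢ b →
                t 3 ≡ b × t 4 ≡ b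
lone-opposite t no-ap t₀ t₁ t₂≢b = t₃ , t₄
  where
  t₂ = ¬-not t₂≢b
  t₃ = trans (sym (¬antiPalindrome-outer (no-ap 0) (≡-not⇒≢ t₁ t₂))) t₀
  t₄ = trans (sym (¬antiPalindrome-outer (no-ap 1) (≢-sym (≡-not⇒≢ t₃ t₂)))) t₁

-- From a repeated value b the sequence reaches the next repeated b after one or three
-- steps, passing at most a single ¬ b on the way; so two consecutive ¬ b never occur.
no-opposite-pair : ∀ (t : ℕ → Bool) {b} → AntiPalindromeFree t → t 0 ≡ b → t 1 ≡ b →
                   ∀ d → ¬ (t d ≡ not b × t (suc d) ≡ not b)
no-opposite-pair-after : ∀ (t : ℕ → Bool) {b} → AntiPalindromeFree t → t 0 ≡ b → t 1 ≡ b →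
                         Dec (t 2 ≡ b) → ∀ d → ¬ (t (suc d) ≡ not b × t (suc (suc d)) ≡ not b)

no-opposite-pair t no-ap t₀ t₁ zero    (t₀′ , _) = ≡-not⇒≢ t₀ t₀′ refl
no-opposite-pair t no-ap t₀ t₁ (suc d) = no-opposite-pair-after t no-ap t₀ t₁ (t 2 ≟ _) d

no-opposite-pair-after t no-ap t₀ t₁ (yes t₂) d =
  no-opposite-pair (t ∘ suc) (no-ap ∘ suc) t₁ t₂ d
no-opposite-pair-after t no-ap t₀ t₁ (no _) zero (t₁′ , _) = ≡-not⇒≢ t₁ t₁′ refl
no-opposite-pair-after t no-ap t₀ t₁ (no t₂≢b) (suc zero) (_ , t₃′) =
  ≡-not⇒≢ (proj₁ (lone-opposite t no-ap t₀ t₁ t₂≢b)) t₃′ refl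
no-opposite-pair-after t no-ap t₀ t₁ (no t₂≢b) (suc (suc d)) =
  let t₃ , t₄ = lone-opposite t no-ap t₀ t₁ t₂≢b
  in no-opposite-pair (λ k → t (3 ℕ.+ k)) (λ k → no-ap (3 ℕ.+ k)) t₃ t₄ d

aligned-pair-sum : ∀ b x y → ¬ (x ≡ not b × y ≡ not b) → 0ℤ ℤ.≤ ± b * (± x + ± y)
aligned-pair-sum true  true  true  _ = +≤+ z≤n
aligned-pair-sum true  true  false _ = +≤+ z≤n
aligned-pair-sum true  false true  _ = +≤+ z≤n
aligned-pair-sum true  false false h = ⊥-elim (h (refl , refl))
aligned-pair-sum false false false _ = +≤+ z≤n
aligned-pair-sum false false true  _ = +≤+ z≤n
aligned-pair-sum false true  false _ = +≤+ z≤n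
aligned-pair-sum false true  true  h = ⊥-elim (h (refl , refl))

repeated-pair-sum : ∀ b → 0ℤ ℤ.< ± b * (± b + ± b)
repeated-pair-sum true  = +<+ (s≤s z≤n)
repeated-pair-sum false = +<+ (s≤s z≤n)

-- Shifted so that the repeated pair b b comes first, the sequence has no pair ¬ b ¬ b; so every
-- pair sum ± s k + ± s (suc k) lies weakly on the side of b, strictly at the repeated pair, yet
-- the pair sums add up to twice the sum of s.
repeated-pair-unbalanced : ∀ {m} {s : ℕ → Bool} → Periodic (suc m) s → AntiPalindromeFree s →
                           ∀ p → s p ≡ s (suc p) → sumUpTo (suc m) (±_ ∘ s) ≢ 0ℤ
repeated-pair-unbalanced {m} {s} per no-ap p repeated Σ≡0 = ℤ.<-irrefl (sym Σh≡0) (sumUpTo-pos m h≥0 h₀>0)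
  where
  b = s p
  g : ℕ → ℤ
  g k = ± s k + ± s (suc k)
  h : ℕ → ℤ
  h k = ± b * g (k ℕ.+ p)
  h≥0 : ∀ k → 0ℤ ℤ.≤ h k
  h≥0 k = aligned-pair-sum b _ _
            (no-opposite-pair (λ j → s (j ℕ.+ p)) (λ j → no-ap (j ℕ.+ p)) refl (sym repeated) k)
  h₀>0 : 0ℤ ℤ.< h 0
  h₀>0 = subst (λ x → 0ℤ ℤ.< ± b * (± b + ± x)) repeated (repeated-pair-sum b)
  Σh≡0 : sumUpTo (suc m) h ≡ 0ℤ
  Σh≡0 = begin
    sumUpTo (suc m) h                            ≡⟨ sumUpTo-*ˡ (suc m) (± b) (λ k → g (k ℕ.+ p)) ⟩
    ± b * sumUpTo (suc m) (λ k → g (k ℕ.+ p))    ≡⟨ cong (± b *_) (sumUpTo-shiftBy g-periodic p) ⟩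
    ± b * sumUpTo (suc m) g                      ≡⟨ cong (± b *_) (sumUpTo-pairs per) ⟩
    ± b * (sumUpTo (suc m) (±_ ∘ s) + sumUpTo (suc m) (±_ ∘ s))
                                                 ≡⟨ cong (λ x → ± b * (x + x)) Σ≡0 ⟩
    ± b * 0ℤ                                     ≡⟨ ℤ.*-zeroʳ (± b) ⟩
    0ℤ                                           ∎
    where
    open ≡-Reasoning
    g-periodic : Periodic (suc m) g
    g-periodic k = cong₂ _+_ (cong ±_ (per k)) (cong ±_ (per (suc k)))

antiPalindrome-exists : ∀ {m} {s : ℕ → Bool} → Periodic (suc m) s → sumUpTo (suc m) (±_ ∘ s) ≡ 0ℤ →
                        ∃ λ k → AntiPalindrome (window s k)
antiPalindrome-exists {m} {s} per Σ≡0 with ℕ.anyUpTo? (antiPalindrome? ∘ window s) (suc m)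
... | yes (k , _ , ap) = k , ap
... | no none =
  let p , repeated = equal-neighbours s (no-ap 0)
  in ⊥-elim (repeated-pair-unbalanced per no-ap p repeated Σ≡0)
  where
  no-ap : AntiPalindromeFree s
  no-ap = periodic-all {P = ¬_ ∘ AntiPalindrome} (window-periodic per)
                       λ k k<m ap → none (k , k<m , ap)

rotate : List A → List A
rotate []       = []
rotate (x ∷ xs) = xs ++ [ x ]

rotateBy : ℕ → List A → List A
rotateBy zero    xs = xs
rotateBy (suc k) xs = rotate (rotateBy k xs)

length-rotate : ∀ (xs : List A) → length (rotate xs) ≡ length xs
length-rotate []       = refl
length-rotate (x ∷ xs) = trans (List.length-++ xs) (ℕ.+-comm (length xs) 1)

length-rotateBy : ∀ k (xs : List A) → length (rotateBy k xs) ≡ length xs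
length-rotateBy zero    xs = refl
length-rotateBy (suc k) xs = trans (length-rotate (rotateBy k xs)) (length-rotateBy k xs)

map-rotate : ∀ (f : A → B) xs → map f (rotate xs) ≡ rotate (map f xs)
map-rotate f []       = refl
map-rotate f (x ∷ xs) = List.map-++ f xs [ x ]

rotateBy-+ : ∀ k j (xs : List A) → rotateBy (k ℕ.+ j) xs ≡ rotateBy k (rotateBy j xs)
rotateBy-+ zero    j xs = refl
rotateBy-+ (suc k) j xs = cong rotate (rotateBy-+ k j xs)

rotateBy-suc : ∀ k (xs : List A) → rotateBy (suc k) xs ≡ rotateBy k (rotate xs)
rotateBy-suc k xs = trans (cong (λ i → rotateBy i xs) (ℕ.+-comm 1 k)) (rotateBy-+ k 1 xs)

rotateBy-++ : ∀ (xs ys : List A) → rotateBy (length xs) (xs ++ ys) ≡ ys ++ xs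
rotateBy-++ []       ys = sym (List.++-identityʳ ys)
rotateBy-++ (x ∷ xs) ys = begin
  rotateBy (suc (length xs)) (x ∷ xs ++ ys)   ≡⟨ rotateBy-suc (length xs) (x ∷ xs ++ ys) ⟩
  rotateBy (length xs) ((xs ++ ys) ++ [ x ])  ≡⟨ cong (rotateBy (length xs)) (List.++-assoc xs ys [ x ]) ⟩
  rotateBy (length xs) (xs ++ ys ++ [ x ])    ≡⟨ rotateBy-++ xs (ys ++ [ x ]) ⟩
  (ys ++ [ x ]) ++ xs                         ≡⟨ List.++-assoc ys [ x ] xs ⟩
  ys ++ x ∷ xs                                ∎
  where open ≡-Reasoning

rotateBy-length : ∀ (xs : List A) → rotateBy (length xs) xs ≡ xs
rotateBy-length xs = trans (cong (rotateBy (length xs)) (sym (List.++-identityʳ xs))) (rotateBy-++ xs [])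

rotateBy-periodic : ∀ (xs : List A) → Periodic (length xs) (λ k → rotateBy k xs)
rotateBy-periodic xs k = trans (rotateBy-+ k (length xs) xs) (cong (rotateBy k) (rotateBy-length xs))

cyclicRead : List Bool → ℕ → Bool
cyclicRead bs k = fromMaybe false (head (rotateBy k bs))

cyclicRead-periodic : ∀ bs → Periodic (length bs) (cyclicRead bs)
cyclicRead-periodic bs k = cong (fromMaybe false ∘ head) (rotateBy-periodic bs k)

signSum : List Bool → ℤ
signSum []       = 0ℤ
signSum (b ∷ bs) = ± b + signSum bs

signSum-++ : ∀ xs ys → signSum (xs ++ ys) ≡ signSum xs + signSum ys
signSum-++ []       ys = sym (ℤ.+-identityˡ (signSum ys))
signSum-++ (x ∷ xs) ys = trans (cong (± x +_) (signSum-++ xs ys)) (sym (ℤ.+-assoc (± x) _ _))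

signSum-rotate : ∀ bs → signSum (rotate bs) ≡ signSum bs
signSum-rotate []       = refl
signSum-rotate (b ∷ bs) = begin
  signSum (bs ++ [ b ])        ≡⟨ signSum-++ bs [ b ] ⟩
  signSum bs + (± b + 0ℤ)      ≡⟨ cong (signSum bs +_) (ℤ.+-identityʳ (± b)) ⟩
  signSum bs + ± b             ≡⟨ ℤ.+-comm (signSum bs) (± b) ⟩
  ± b + signSum bs             ∎
  where open ≡-Reasoning

signSum-rotateBy : ∀ k bs → signSum (rotateBy k bs) ≡ signSum bs
signSum-rotateBy zero    bs = refl
signSum-rotateBy (suc k) bs = trans (signSum-rotate (rotateBy k bs)) (signSum-rotateBy k bs)

sumUpTo-cyclicRead : ∀ bs → sumUpTo (length bs) (±_ ∘ cyclicRead bs) ≡ signSum bs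
sumUpTo-cyclicRead bs =
  trans (sumUpTo-cong (length bs) λ k → cong (λ xs → ± cyclicRead xs k) (sym (List.++-identityʳ bs)))
        (prefix bs [])
  where
  prefix : ∀ bs cs → sumUpTo (length bs) (λ k → ± cyclicRead (bs ++ cs) k) ≡ signSum bs
  prefix []       cs = refl
  prefix (b ∷ bs) cs = cong (± b +_) (trans (sumUpTo-cong (length bs) shift) (prefix bs (cs ++ [ b ])))
    where
    shift : ∀ k → ± cyclicRead (b ∷ bs ++ cs) (suc k) ≡ ± cyclicRead (bs ++ cs ++ [ b ]) k
    shift k = cong (±_ ∘ fromMaybe false ∘ head)
                   (trans (rotateBy-suc k (b ∷ bs ++ cs)) (cong (rotateBy k) (List.++-assoc bs cs [ b ])))

-- The weight of a cycle

ascent? : Fin n × Fin n → Bool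
ascent? (x , y) = does (x <? y)

signs : List (Fin n) → List Bool
signs L = map ascent? (cyclicPairs L)

weight : List (Fin n) → ℤ
weight L = signSum (signs L)

ascent?-< : ∀ {x y : Fin n} → x < y → ascent? (x , y) ≡ true
ascent?-< {x = x} {y} = dec-true (x <? y)

ascent?-> : ∀ {x y : Fin n} → y < x → ascent? (x , y) ≡ false
ascent?-> {x = x} {y} y<x = dec-false (x <? y) (Fin.<-asym y<x)

true≢false : true ≢ false
true≢false ()

ascent?-true : ∀ {x y : Fin n} → ascent? (x , y) ≡ true → x < y
ascent?-true {x = x} {y} eq =
  decidable-stable (x <? y) λ x≮y → true≢false (trans (sym eq) (dec-false (x <? y) x≮y))

ascent?-false : ∀ {x y : Fin n} → ascent? (x , y) ≡ false → y ≤ x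
ascent?-false eq = ℕ.≮⇒≥ λ x<y → true≢false (trans (sym (ascent?-< x<y)) eq)

±-ascent?-flip : ∀ {x y : Fin n} → x ≢ y → ± ascent? (y , x) ≡ - ± ascent? (x , y)
±-ascent?-flip {x = x} {y} x≢y with Fin.<-cmp x y
... | tri< x<y _ _ rewrite ascent?-< x<y | ascent?-> x<y = refl
... | tri≈ _ x≡y _ = ⊥-elim (x≢y x≡y)
... | tri> _ _ y<x rewrite ascent?-< y<x | ascent?-> y<x = refl

weight³ : ∀ {x y z : Fin n} {p q r} → ascent? (x , y) ≡ p → ascent? (y , z) ≡ q → ascent? (z , x) ≡ r →
          weight (x ∷ y ∷ z ∷ []) ≡ ± p + (± q + (± r + 0ℤ))
weight³ refl refl refl = refl

weight⁴ : ∀ {x y z w : Fin n} {p q r s} →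
          ascent? (x , y) ≡ p → ascent? (y , z) ≡ q → ascent? (z , w) ≡ r → ascent? (w , x) ≡ s →
          weight (x ∷ y ∷ z ∷ w ∷ []) ≡ ± p + (± q + (± r + (± s + 0ℤ)))
weight⁴ refl refl refl refl = refl

pairs : List A → List (A × A)
pairs (x ∷ y ∷ zs) = (x , y) ∷ pairs (y ∷ zs)
pairs _            = []

pairs-++ : ∀ (xs : List A) y ys → pairs (xs ++ y ∷ ys) ≡ pairs (xs ++ [ y ]) ++ pairs (y ∷ ys)
pairs-++ []            y ys = refl
pairs-++ (x ∷ [])      y ys = refl
pairs-++ (x ∷ x′ ∷ xs) y ys = cong ((x , x′) ∷_) (pairs-++ (x′ ∷ xs) y ys)

zip-pairs : ∀ (y : A) ys x → zip (y ∷ ys) (ys ++ [ x ]) ≡ pairs (y ∷ ys ++ [ x ])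
zip-pairs y []       x = refl
zip-pairs y (z ∷ zs) x = cong ((y , z) ∷_) (zip-pairs z zs x)

cyclicPairs-pairs : ∀ (x : Fin n) xs → cyclicPairs (x ∷ xs) ≡ pairs (x ∷ xs ++ [ x ])
cyclicPairs-pairs x xs = zip-pairs x xs x

cyclicPairs-rotate : ∀ (L : List (Fin n)) → cyclicPairs (rotate L) ≡ rotate (cyclicPairs L)
cyclicPairs-rotate []           = refl
cyclicPairs-rotate (x ∷ [])     = refl
cyclicPairs-rotate (x ∷ y ∷ ys) = begin
  cyclicPairs (y ∷ ys ++ [ x ])            ≡⟨ cyclicPairs-pairs y (ys ++ [ x ]) ⟩
  pairs (y ∷ (ys ++ [ x ]) ++ [ y ])      ≡⟨ cong (pairs ∘ (y ∷_)) (List.++-assoc ys [ x ] [ y ]) ⟩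
  pairs ((y ∷ ys) ++ x ∷ [ y ])           ≡⟨ pairs-++ (y ∷ ys) x [ y ] ⟩
  pairs (y ∷ ys ++ [ x ]) ++ [ (x , y) ]  ≡⟨ cong (_++ [ (x , y) ]) (sym (zip-pairs y ys x)) ⟩
  rotate (cyclicPairs (x ∷ y ∷ ys))       ∎
  where open ≡-Reasoning

signs-rotateBy : ∀ k (L : List (Fin n)) → signs (rotateBy k L) ≡ rotateBy k (signs L)
signs-rotateBy zero    L = refl
signs-rotateBy (suc k) L = begin
  map ascent? (cyclicPairs (rotate (rotateBy k L)))  ≡⟨ cong (map ascent?) (cyclicPairs-rotate (rotateBy k L)) ⟩
  map ascent? (rotate (cyclicPairs (rotateBy k L)))  ≡⟨ map-rotate ascent? (cyclicPairs (rotateBy k L)) ⟩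
  rotate (signs (rotateBy k L))                      ≡⟨ cong rotate (signs-rotateBy k L) ⟩
  rotate (rotateBy k (signs L))                      ∎
  where open ≡-Reasoning

weight-rotateBy : ∀ k (L : List (Fin n)) → weight (rotateBy k L) ≡ weight L
weight-rotateBy k L = trans (cong signSum (signs-rotateBy k L)) (signSum-rotateBy k (signs L))

all-rotate : ∀ {P : A → Set} {xs} → All P xs → All P (rotate xs)
all-rotate []         = []
all-rotate (px ∷ pxs) = All.++⁺ pxs (px ∷ [])

unique-rotate : ∀ {xs : List A} → Unique xs → Unique (rotate xs)
unique-rotate []             = []
unique-rotate (x∉xs ∷ uxs) = AllPairs.++⁺ uxs ([] ∷ []) (All.map (λ x≢y → (x≢y ∘ sym) ∷ []) x∉xs)

module _ {T : Tournament n} where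

  rotate-cycle : ∀ {L} → IsDirectedCycle T L → IsDirectedCycle T (rotate L)
  rotate-cycle {L} (3≤ , unique , edges) =
    subst (3 ℕ.≤_) (sym (length-rotate L)) 3≤ ,
    unique-rotate unique ,
    subst (All _) (sym (cyclicPairs-rotate L)) (all-rotate edges)

  rotateBy-cycle : ∀ k {L} → IsDirectedCycle T L → IsDirectedCycle T (rotateBy k L)
  rotateBy-cycle zero    cycle = cycle
  rotateBy-cycle (suc k) cycle = rotate-cycle (rotateBy-cycle k cycle)

  cyclicPairs-distinct : ∀ {L} → IsDirectedCycle T L → All (λ p → proj₁ p ≢ proj₂ p) (cyclicPairs L)
  cyclicPairs-distinct (_ , _ , edges) =
    All.map (λ {(x , _)} e x≡y → loopless T x (subst (Edge T x) (sym x≡y) e)) edges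

0≤⇔≤+ : ∀ {i} j → 0ℤ ℤ.≤ j ⇔ i ℤ.≤ j + i
0≤⇔≤+ {i} j = mk⇔
  (λ 0≤j → subst (ℤ._≤ j + i) (ℤ.+-identityˡ i) (ℤ.+-monoˡ-≤ i 0≤j))
  (λ i≤j+i → subst₂ ℤ._≤_ (ℤ.+-inverseʳ i) (cancel j i) (ℤ.+-monoˡ-≤ (- i) i≤j+i))
  where
  cancel : ∀ j i → j + i + - i ≡ j
  cancel = solve-∀

ascents-balance : ∀ (ps : List (Fin n × Fin n)) → All (λ p → proj₁ p ≢ proj₂ p) ps →
                  ℤ.+ length (filter (λ p → proj₁ p <? proj₂ p) ps)
                    ≡ signSum (map ascent? ps) + ℤ.+ length (filter (λ p → proj₂ p <? proj₁ p) ps)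
ascents-balance []             []           = refl
ascents-balance ((x , y) ∷ ps) (x≢y ∷ ds) with Fin.<-cmp x y
... | tri< x<y _ _
  rewrite List.filter-accept (λ p → proj₁ p <? proj₂ p) {x = x , y} {xs = ps} x<y
        | List.filter-reject (λ p → proj₂ p <? proj₁ p) {x = x , y} {xs = ps} (Fin.<-asym x<y)
        | ascent?-< x<y
  = trans (cong (1ℤ +_) (ascents-balance ps ds)) (sym (ℤ.+-assoc 1ℤ (signSum (map ascent? ps)) _))
... | tri≈ _ x≡y _ = ⊥-elim (x≢y x≡y)
... | tri> _ _ y<x
  rewrite List.filter-reject (λ p → proj₁ p <? proj₂ p) {x = x , y} {xs = ps} (Fin.<-asym y<x)
        | List.filter-accept (λ p → proj₂ p <? proj₁ p) {x = x , y} {xs = ps} y<x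
        | ascent?-> y<x
  = trans (ascents-balance ps ds) (shift (signSum (map ascent? ps)) _)
  where
  shift : ∀ s d → s + d ≡ (-1ℤ + s) + (1ℤ + d)
  shift = solve-∀

ascending⇔nonnegative : ∀ {T : Tournament n} {L} → IsDirectedCycle T L → Ascending L ⇔ 0ℤ ℤ.≤ weight L
ascending⇔nonnegative {T = T} {L} cycle = mk⇔
  (λ d≤a → Equivalence.from (0≤⇔≤+ (weight L)) (subst (ℤ.+ descents L ℤ.≤_) balance (+≤+ d≤a)))
  (λ 0≤w → ℤ.drop‿+≤+ (subst (ℤ.+ descents L ℤ.≤_) (sym balance) (Equivalence.to (0≤⇔≤+ (weight L)) 0≤w)))
  where balance = ascents-balance (cyclicPairs L) (cyclicPairs-distinct {T = T} cycle)

-- Chords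

unique-⊆ : ∀ {xs ys : List A} → xs ⊆ ys → Unique ys → Unique xs
unique-⊆ []             []           = []
unique-⊆ (y ∷ʳ xs⊆ys)   (_ ∷ u)      = unique-⊆ xs⊆ys u
unique-⊆ (refl ∷ xs⊆ys) (y∉ys ∷ u)   = All-resp-⊆ xs⊆ys y∉ys ∷ unique-⊆ xs⊆ys u

signSum-map-++ : ∀ (ps qs : List (Fin n × Fin n)) →
                 signSum (map ascent? (ps ++ qs)) ≡ signSum (map ascent? ps) + signSum (map ascent? qs)
signSum-map-++ ps qs = trans (cong signSum (List.map-++ ascent? ps qs)) (signSum-++ (map ascent? ps) _)

-- A chord {x, y} of the cycle x ∷ A ++ y ∷ B splits it into the arc cycle x ∷ A ++ [ y ]
-- (closed by y → x) and the shortcut cycle x ∷ y ∷ B (opened by x → y).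
cyclicPairs-chord : ∀ (x : Fin n) A y B →
                    cyclicPairs (x ∷ A ++ y ∷ B) ≡ pairs (x ∷ A ++ [ y ]) ++ pairs (y ∷ B ++ [ x ])
cyclicPairs-chord x A y B = begin
  cyclicPairs (x ∷ A ++ y ∷ B)                       ≡⟨ cyclicPairs-pairs x (A ++ y ∷ B) ⟩
  pairs (x ∷ (A ++ y ∷ B) ++ [ x ])                  ≡⟨ cong (pairs ∘ (x ∷_)) (List.++-assoc A (y ∷ B) [ x ]) ⟩
  pairs ((x ∷ A) ++ y ∷ B ++ [ x ])                  ≡⟨ pairs-++ (x ∷ A) y (B ++ [ x ]) ⟩
  pairs (x ∷ A ++ [ y ]) ++ pairs (y ∷ B ++ [ x ])   ∎
  where open ≡-Reasoning

weight-chord : ∀ {x y : Fin n} A B → x ≢ y →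
               weight (x ∷ y ∷ B) + weight (x ∷ A ++ [ y ]) ≡ weight (x ∷ A ++ y ∷ B)
weight-chord {x = x} {y} A B x≢y = begin
  weight (x ∷ y ∷ B) + weight (x ∷ A ++ [ y ])
    ≡⟨ cong₂ _+_ (cong (signSum ∘ map ascent?) (cyclicPairs-pairs x (y ∷ B)))
                 (trans (cong (signSum ∘ map ascent?) (cyclicPairs-chord x A y [])) (signSum-map-++ P _)) ⟩
  (± ascent? (x , y) + w Q) + (w P + (± ascent? (y , x) + 0ℤ))
    ≡⟨ cong (λ a → (± ascent? (x , y) + w Q) + (w P + (a + 0ℤ))) (±-ascent?-flip x≢y) ⟩
  (± ascent? (x , y) + w Q) + (w P + (- ± ascent? (x , y) + 0ℤ))
    ≡⟨ cancel (± ascent? (x , y)) (w P) (w Q) ⟩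
  w P + w Q
    ≡⟨ trans (cong (signSum ∘ map ascent?) (cyclicPairs-chord x A y B)) (signSum-map-++ P Q) ⟨
  weight (x ∷ A ++ y ∷ B) ∎
  where
  open ≡-Reasoning
  P = pairs (x ∷ A ++ [ y ])
  Q = pairs (y ∷ B ++ [ x ])
  w : List (Fin _ × Fin _) → ℤ
  w = signSum ∘ map ascent?
  cancel : ∀ a p q → (a + q) + (p + (- a + 0ℤ)) ≡ p + q
  cancel = solve-∀

module _ {x y : A} (L₁ L₂ : List A) where

  arc-shorter : 0 ℕ.< length L₂ → length (x ∷ L₁ ++ [ y ]) ℕ.< length (x ∷ L₁ ++ y ∷ L₂)
  arc-shorter 0<|L₂| = s≤s (subst₂ ℕ._<_ (sym (List.length-++ L₁)) (sym (List.length-++ L₁))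
                                 (ℕ.+-monoʳ-< (length L₁) (s≤s 0<|L₂|)))

  shortcut-shorter : 0 ℕ.< length L₁ → length (x ∷ y ∷ L₂) ℕ.< length (x ∷ L₁ ++ y ∷ L₂)
  shortcut-shorter 0<|L₁| = s≤s (subst (suc (length L₂) ℕ.<_) (sym (List.length-++ L₁))
                                      (ℕ.+-monoˡ-< (suc (length L₂)) 0<|L₁|))

module _ {T : Tournament n} {x y : Fin n} (A B : List (Fin n)) where

  arc-cycle : 0 ℕ.< length A → IsDirectedCycle T (x ∷ A ++ y ∷ B) → Edge T y x →
              IsDirectedCycle T (x ∷ A ++ [ y ])
  arc-cycle 0<|A| (_ , unique , edges) y→x =
    s≤s (subst (2 ℕ.≤_) (sym (List.length-++ A)) (ℕ.+-monoˡ-≤ 1 0<|A|)) ,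
    unique-⊆ (refl ∷ ++⁺ (⊆-refl {x = A}) (++⁺ʳ B (⊆-refl {x = [ y ]}))) unique ,
    subst (All _) (sym (cyclicPairs-chord x A y []))
      (All.++⁺ (All.++⁻ˡ _ (subst (All _) (cyclicPairs-chord x A y B) edges)) (y→x ∷ []))

  shortcut-cycle : 0 ℕ.< length B → IsDirectedCycle T (x ∷ A ++ y ∷ B) → Edge T x y →
                   IsDirectedCycle T (x ∷ y ∷ B)
  shortcut-cycle 0<|B| (_ , unique , edges) x→y =
    s≤s (s≤s 0<|B|) ,
    unique-⊆ (refl ∷ ++⁺ˡ A ⊆-refl) unique ,
    subst (All _) (sym (cyclicPairs-pairs x (y ∷ B)))
      (x→y ∷ All.++⁻ʳ (pairs (x ∷ A ++ [ y ])) (subst (All _) (cyclicPairs-chord x A y B) edges))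


NoAscendingCycleBelow : Tournament n → ℕ → Set
NoAscendingCycleBelow T m = ∀ L → length L ℕ.< m → IsDirectedCycle T L → ¬ (0ℤ ℤ.≤ weight L)

ForbidsC₀ : Tournament n → Set
ForbidsC₀ {n} T = ∀ (a b c : Fin n) → a < b → b < c → ¬ IsDirectedCycle T (a ∷ b ∷ c ∷ [])

ForbidsC₁₋₄ : Tournament n → Set
ForbidsC₁₋₄ {n} T = ∀ (a b c d : Fin n) → a < b → b < c → c < d →
  ¬ IsDirectedCycle T (a ∷ c ∷ b ∷ d ∷ []) × ¬ IsDirectedCycle T (a ∷ d ∷ b ∷ c ∷ []) ×
  ¬ IsDirectedCycle T (a ∷ b ∷ d ∷ c ∷ []) × ¬ IsDirectedCycle T (a ∷ c ∷ d ∷ b ∷ [])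

-- Rotating a cycle into a normal form

data StartsAscending {n} : List (Fin n) → Set where
  ascending : ∀ {x y z R} → x < y → y < z → StartsAscending (x ∷ y ∷ z ∷ R)

data StartsWithAntiPalindrome {n} : List (Fin n) → Set where
  antiPalindrome : ∀ {v₀ v₁ v₂ v₃ v₄ R} →
                   AntiPalindrome (ascent? (v₀ , v₁) , ascent? (v₁ , v₂) ,
                                   ascent? (v₂ , v₃) , ascent? (v₃ , v₄)) →
                   StartsWithAntiPalindrome (v₀ ∷ v₁ ∷ v₂ ∷ v₃ ∷ v₄ ∷ R)

data StartsWithMinimum {n} : List (Fin n) → Set where
  minimum-first : ∀ {x R} → All (x ≤_) R → StartsWithMinimum (x ∷ R)

ascending-rotation : ∀ (L : List (Fin n)) → 3 ℕ.≤ length L → 0ℤ ℤ.< weight L →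
                     ∃ λ k → StartsAscending (rotateBy k L)
ascending-rotation L 3≤|L| 0<w =
  let k , s₀ , s₁ = consecutive-trues (cyclicRead-periodic (signs L))
                      (subst (0ℤ ℤ.<_) (sym (sumUpTo-cyclicRead (signs L))) 0<w)
      read j = cong (λ bs → cyclicRead bs j) (signs-rotateBy k L)
  in k , starts (rotateBy k L) (subst (3 ℕ.≤_) (sym (length-rotateBy k L)) 3≤|L|)
                (trans (read 0) s₀) (trans (read 1) s₁)
  where
  starts : ∀ L → 3 ℕ.≤ length L → cyclicRead (signs L) 0 ≡ true → cyclicRead (signs L) 1 ≡ true →
           StartsAscending L
  starts (x ∷ y ∷ z ∷ R) _                   s₀ s₁ = ascending (ascent?-true s₀) (ascent?-true s₁)
  starts []             ()                   _  _
  starts (_ ∷ [])        (s≤s ())             _  _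
  starts (_ ∷ _ ∷ [])    (s≤s (s≤s ()))       _  _

antiPalindrome-rotation : ∀ (L : List (Fin n)) → 5 ℕ.≤ length L → weight L ≡ 0ℤ →
                          ∃ λ k → StartsWithAntiPalindrome (rotateBy k L)
antiPalindrome-rotation L@(_ ∷ _ ∷ _) 5≤|L| w≡0 =
  let k , ap = antiPalindrome-exists (cyclicRead-periodic (signs L))
                 (trans (sumUpTo-cyclicRead (signs L)) w≡0)
      read = cong (λ bs → window (cyclicRead bs) 0) (sym (signs-rotateBy k L))
  in k , starts (rotateBy k L) (subst (5 ℕ.≤_) (sym (length-rotateBy k L)) 5≤|L|) (subst AntiPalindrome read ap)
  where
  starts : ∀ L → 5 ℕ.≤ length L → AntiPalindrome (window (cyclicRead (signs L)) 0) →
           StartsWithAntiPalindrome L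
  starts (_ ∷ _ ∷ _ ∷ _ ∷ _ ∷ _) _ ap = antiPalindrome ap
  starts []                  ()                               _
  starts (_ ∷ [])             (s≤s ())                         _
  starts (_ ∷ _ ∷ [])         (s≤s (s≤s ()))                   _
  starts (_ ∷ _ ∷ _ ∷ [])     (s≤s (s≤s (s≤s ())))             _
  starts (_ ∷ _ ∷ _ ∷ _ ∷ []) (s≤s (s≤s (s≤s (s≤s ()))))       _
antiPalindrome-rotation (_ ∷ []) (s≤s ()) _

module _ {n : ℕ} where
  open import Data.List.Extrema (Fin.≤-totalOrder n) using (min; min≤⊤; min≤xs; argmin-all)

  minimum-rotation : ∀ (x : Fin n) xs → ∃ λ k → StartsWithMinimum (rotateBy k (x ∷ xs))
  minimum-rotation x xs =
    let ys , zs , split = ∈-∃++ (argmin-all id (here refl) (All.tabulate there))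
        below = subst (All (min x xs ≤_)) split (min≤⊤ x xs ∷ min≤xs x xs)
        rotated = trans (cong (rotateBy (length ys)) split) (rotateBy-++ ys (min x xs ∷ zs))
    in length ys ,
       subst StartsWithMinimum (sym rotated)
             (minimum-first (All.++⁺ (All.tail (All.++⁻ʳ ys below)) (All.++⁻ˡ ys below)))

nonzero-pair-equal : ∀ p q → ± p + ± q ≢ 0ℤ → q ≡ p
nonzero-pair-equal true  true  _ = refl
nonzero-pair-equal false false _ = refl
nonzero-pair-equal true  false h = ⊥-elim (h refl)
nonzero-pair-equal false true  h = ⊥-elim (h refl)

-- For a = true this is the cycle u₀ < u₁ ≤ u₄ ≤ u₃ < u₀; for a = false, its mirror image.
no-cyclic-order : ∀ {u₀ u₁ u₃ u₄ : Fin n} a → ascent? (u₀ , u₁) ≡ a → ascent? (u₃ , u₄) ≡ not a →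
                  ascent? (u₃ , u₀) ≡ a → ascent? (u₄ , u₁) ≡ not a → ⊥
no-cyclic-order {u₀ = u₀} {u₁} {u₃} {u₄} true e₀₁ e₃₄ e₃₀ e₄₁ = Fin.<-irrefl refl
  (ℕ.<-trans (ℕ.<-≤-trans (ascent?-true {x = u₀} {u₁} e₀₁)
                          (ℕ.≤-trans (ascent?-false {x = u₄} {u₁} e₄₁) (ascent?-false {x = u₃} {u₄} e₃₄)))
             (ascent?-true {x = u₃} {u₀} e₃₀))
no-cyclic-order {u₀ = u₀} {u₁} {u₃} {u₄} false e₀₁ e₃₄ e₃₀ e₄₁ = Fin.<-irrefl refl
  (ℕ.≤-<-trans (ascent?-false {x = u₃} {u₀} e₃₀)
    (ℕ.<-trans (ascent?-true {x = u₃} {u₄} e₃₄)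
               (ℕ.<-≤-trans (ascent?-true {x = u₄} {u₁} e₄₁) (ascent?-false {x = u₀} {u₁} e₀₁))))

0<length-∷ʳ : ∀ (xs : List A) x → 0 ℕ.< length (xs ++ [ x ])
0<length-∷ʳ []      x = s≤s z≤n
0<length-∷ʳ (_ ∷ _) x = s≤s z≤n

module _ {T : Tournament n} {m : ℕ} (shorter : NoAscendingCycleBelow T m) where

  chord : ∀ x A y B → 0 ℕ.< length A → 0 ℕ.< length B → length (x ∷ A ++ y ∷ B) ℕ.≤ m →
          IsDirectedCycle T (x ∷ A ++ y ∷ B) →
          ¬ (0ℤ ℤ.≤ weight (x ∷ A ++ [ y ]) × weight (x ∷ A ++ [ y ]) ℤ.≤ weight (x ∷ A ++ y ∷ B))
  chord x A y B 0<|A| 0<|B| |L|≤m cycle@(_ , x∉ ∷ _ , _) (0≤arc , arc≤w) =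
    [ (λ x→y → shorter (x ∷ y ∷ B) (ℕ.<-≤-trans (shortcut-shorter {x = x} {y} A B 0<|A|) |L|≤m)
                 (shortcut-cycle {T = T} A B 0<|B| cycle x→y)
                 (Equivalence.from (0≤⇔≤+ (weight (x ∷ y ∷ B)))
                   (subst (weight (x ∷ A ++ [ y ]) ℤ.≤_) (sym (weight-chord A B x≢y)) arc≤w)))
    , (λ y→x → shorter (x ∷ A ++ [ y ]) (ℕ.<-≤-trans (arc-shorter {x = x} {y} A B 0<|B|) |L|≤m)
                 (arc-cycle {T = T} A B 0<|A| cycle y→x) 0≤arc)
    ]′ (total T x y x≢y)
    where
    x≢y : x ≢ y
    x≢y = All.lookup x∉ (∈-++⁺ʳ A (here refl))

  chord-balanced : ∀ x A y B → 0 ℕ.< length A → 0 ℕ.< length B → length (x ∷ A ++ y ∷ B) ℕ.≤ m →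
                   IsDirectedCycle T (x ∷ A ++ y ∷ B) → weight (x ∷ A ++ y ∷ B) ≡ 0ℤ →
                   weight (x ∷ A ++ [ y ]) ≢ 0ℤ
  chord-balanced x A y B 0<|A| 0<|B| |L|≤m cycle w≡0 arc≡0 =
    chord x A y B 0<|A| 0<|B| |L|≤m cycle (ℤ.≤-reflexive (sym arc≡0) , ℤ.≤-reflexive (trans arc≡0 (sym w≡0)))

  positive-impossible : ForbidsC₀ T → ∀ {L} → StartsAscending L → length L ℕ.≤ m → IsDirectedCycle T L →
                        0ℤ ℤ.< weight L → ⊥
  positive-impossible forbids₀ (ascending {x} {y} {z} {[]} x<y y<z) _ cycle _ = forbids₀ x y z x<y y<z cycle
  positive-impossible _ (ascending {x} {y} {z} {r ∷ R} x<y y<z) |L|≤m cycle 0<w =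
    chord x (y ∷ []) z (r ∷ R) (s≤s z≤n) (s≤s z≤n) |L|≤m cycle
      (subst (0ℤ ℤ.≤_) (sym arc≡1) (+≤+ z≤n) ,
       subst (ℤ._≤ weight (x ∷ y ∷ z ∷ r ∷ R)) (sym arc≡1) (ℤ.i<j⇒suc[i]≤j 0<w))
    where
    arc≡1 : weight (x ∷ y ∷ z ∷ []) ≡ 1ℤ
    arc≡1 = weight³ {x = x} {y} {z} (ascent?-< x<y) (ascent?-< y<z) (ascent?-> (Fin.<-trans x<y y<z))

  -- Neither chord {v₀, v₃} nor {v₁, v₄} may cut off a balanced quadrilateral; this
  -- orients both of them, and the resulting four comparisons close up into a cycle.
  antiPalindrome-impossible : ∀ {L} → StartsWithAntiPalindrome L → length L ℕ.≤ m → IsDirectedCycle T L →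
                              weight L ≡ 0ℤ → ⊥
  antiPalindrome-impossible (antiPalindrome {v₀} {v₁} {v₂} {v₃} {v₄} {R} (b≢c , a≢d)) |L|≤m cycle w≡0 =
    no-cyclic-order {u₀ = v₀} {v₁} {v₃} {v₄} a refl d≡¬a e≡a f≡¬a
    where
    a = ascent? (v₀ , v₁)
    b = ascent? (v₁ , v₂)
    c≡¬b : ascent? (v₂ , v₃) ≡ not b
    c≡¬b = ¬-not (≢-sym b≢c)
    d≡¬a : ascent? (v₃ , v₄) ≡ not a
    d≡¬a = ¬-not (≢-sym a≢d)
    cancel-middle : ∀ p q r → p + (q + (- q + (r + 0ℤ))) ≡ p + r
    cancel-middle = solve-∀
    cancel-front : ∀ p q r → p + (- p + (q + (r + 0ℤ))) ≡ q + r
    cancel-front = solve-∀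
    e≡a : ascent? (v₃ , v₀) ≡ a
    e≡a = nonzero-pair-equal a _ λ a+e≡0 →
      chord-balanced v₀ (v₁ ∷ v₂ ∷ []) v₃ (v₄ ∷ R) (s≤s z≤n) (s≤s z≤n) |L|≤m cycle w≡0
        (trans (weight⁴ {x = v₀} {v₁} {v₂} {v₃} refl refl c≡¬b refl)
          (trans (cong (λ t → ± a + (± b + (t + (± ascent? (v₃ , v₀) + 0ℤ)))) (±-not b))
            (trans (cancel-middle (± a) (± b) _) a+e≡0)))
    f≡¬a : ascent? (v₄ , v₁) ≡ not a
    f≡¬a = nonzero-pair-equal (not a) _ λ ¬a+f≡0 →
      chord-balanced v₁ (v₂ ∷ v₃ ∷ []) v₄ (R ++ [ v₀ ]) (s≤s z≤n) (0<length-∷ʳ R v₀)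
        (subst (ℕ._≤ m) (sym (length-rotate (v₀ ∷ v₁ ∷ v₂ ∷ v₃ ∷ v₄ ∷ R))) |L|≤m)
        (rotate-cycle {T = T} cycle) (trans (weight-rotateBy 1 (v₀ ∷ v₁ ∷ v₂ ∷ v₃ ∷ v₄ ∷ R)) w≡0)
        (trans (weight⁴ {x = v₁} {v₂} {v₃} {v₄} refl c≡¬b d≡¬a refl)
          (trans (cong (λ t → ± b + (t + (± not a + (± ascent? (v₄ , v₁) + 0ℤ)))) (±-not b))
            (trans (cancel-front (± b) (± not a) _) ¬a+f≡0)))

triangle-unbalanced : ∀ (x y z : Fin n) → weight (x ∷ y ∷ z ∷ []) ≢ 0ℤ
triangle-unbalanced x y z = odd (ascent? (x , y)) (ascent? (y , z)) (ascent? (z , x))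
  where
  odd : ∀ p q r → ± p + (± q + (± r + 0ℤ)) ≢ 0ℤ
  odd true  true  true  ()
  odd true  true  false ()
  odd true  false true  ()
  odd true  false false ()
  odd false true  true  ()
  odd false true  false ()
  odd false false true  ()
  odd false false false ()

module _ {T : Tournament n} (forbids₁₋₄ : ForbidsC₁₋₄ T) where

  quadrilateral-impossible : ∀ {L} → StartsWithMinimum L → length L ≡ 4 → IsDirectedCycle T L →
                             weight L ≡ 0ℤ → ⊥
  quadrilateral-impossible (minimum-first {a} {b ∷ c ∷ d ∷ []} (a≤b ∷ a≤c ∷ a≤d ∷ [])) refl
    cycle@(_ , (a≢b ∷ a≢c ∷ a≢d ∷ []) ∷ (b≢c ∷ b≢d ∷ []) ∷ (c≢d ∷ []) ∷ _ , _) w≡0 =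
    by-signs (ascent? (b , c)) (ascent? (c , d)) refl refl
      (trans (sym (weight⁴ {x = a} {b} {c} {d} (ascent?-< a<b) refl refl (ascent?-> a<d))) w≡0)
    where
    a<b = Fin.≤∧≢⇒< a≤b a≢b
    a<c = Fin.≤∧≢⇒< a≤c a≢c
    a<d = Fin.≤∧≢⇒< a≤d a≢d
    by-signs : ∀ q r → ascent? (b , c) ≡ q → ascent? (c , d) ≡ r →
               ± true + (± q + (± r + (± false + 0ℤ))) ≡ 0ℤ → ⊥
    by-signs true  true  _ _ ()
    by-signs false false _ _ ()
    by-signs true false b↑c c↓d _ with Fin.<-cmp b d
    ... | tri< b<d _ _ = proj₁ (proj₂ (proj₂ (forbids₁₋₄ a b d c a<b b<d d<c))) cycle
      where d<c = Fin.≤∧≢⇒< (ascent?-false {x = c} {d} c↓d) (c≢d ∘ sym)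
    ... | tri≈ _ b≡d _ = b≢d b≡d
    ... | tri> _ _ d<b = proj₂ (proj₂ (proj₂ (forbids₁₋₄ a d b c a<d d<b (ascent?-true {x = b} {c} b↑c)))) cycle
    by-signs false true b↓c c↑d _ with Fin.<-cmp b d
    ... | tri< b<d _ _ = proj₁ (forbids₁₋₄ a c b d a<c c<b b<d) cycle
      where c<b = Fin.≤∧≢⇒< (ascent?-false {x = b} {c} b↓c) (b≢c ∘ sym)
    ... | tri≈ _ b≡d _ = b≢d b≡d
    ... | tri> _ _ d<b = proj₁ (proj₂ (forbids₁₋₄ a c d b a<c (ascent?-true {x = c} {d} c↑d) d<b)) cycle
  quadrilateral-impossible (minimum-first {R = []} _)                  ()
  quadrilateral-impossible (minimum-first {R = _ ∷ []} _)              ()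
  quadrilateral-impossible (minimum-first {R = _ ∷ _ ∷ []} _)          ()
  quadrilateral-impossible (minimum-first {R = _ ∷ _ ∷ _ ∷ _ ∷ _} _)   ()

module _ {T : Tournament n} (forbids₀ : ForbidsC₀ T) (forbids₁₋₄ : ForbidsC₁₋₄ T) where

  module _ {m : ℕ} (shorter : NoAscendingCycleBelow T m) where

    balanced-impossible : ∀ L → length L ℕ.≤ m → IsDirectedCycle T L → weight L ≡ 0ℤ → ⊥
    balanced-impossible (x ∷ y ∷ z ∷ []) _ _ w≡0 = triangle-unbalanced x y z w≡0
    balanced-impossible L@(x ∷ xs@(_ ∷ _ ∷ _ ∷ [])) _ cycle w≡0 =
      let k , starts = minimum-rotation x xs
      in quadrilateral-impossible {T = T} forbids₁₋₄ starts (length-rotateBy k L)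
           (rotateBy-cycle {T = T} k cycle) (trans (weight-rotateBy k L) w≡0)
    balanced-impossible L@(_ ∷ _ ∷ _ ∷ _ ∷ _ ∷ _) |L|≤m cycle w≡0 =
      let k , starts = antiPalindrome-rotation L (s≤s (s≤s (s≤s (s≤s (s≤s z≤n))))) w≡0
      in antiPalindrome-impossible {T = T} shorter starts (subst (ℕ._≤ m) (sym (length-rotateBy k L)) |L|≤m)
           (rotateBy-cycle {T = T} k cycle) (trans (weight-rotateBy k L) w≡0)
    balanced-impossible []           _ (() , _)           _
    balanced-impossible (_ ∷ [])     _ (s≤s () , _)       _
    balanced-impossible (_ ∷ _ ∷ []) _ (s≤s (s≤s ()) , _) _

    nonnegative-impossible : ∀ L → length L ℕ.≤ m → IsDirectedCycle T L → ¬ (0ℤ ℤ.≤ weight L)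
    nonnegative-impossible L |L|≤m cycle 0≤w with ℤ.<-cmp 0ℤ (weight L)
    ... | tri< 0<w _ _ =
      let k , starts = ascending-rotation L (proj₁ cycle) 0<w
      in positive-impossible {T = T} shorter forbids₀ starts (subst (ℕ._≤ m) (sym (length-rotateBy k L)) |L|≤m)
           (rotateBy-cycle {T = T} k cycle) (subst (0ℤ ℤ.<_) (sym (weight-rotateBy k L)) 0<w)
    ... | tri≈ _ 0≡w _ = balanced-impossible L |L|≤m cycle (sym 0≡w)
    ... | tri> _ _ w<0 = ℤ.<⇒≱ w<0 0≤w

  no-ascending-cycle-below : ∀ m → NoAscendingCycleBelow T m
  no-ascending-cycle-below (suc m) L (s≤s |L|≤m) = nonnegative-impossible (no-ascending-cycle-below m) L |L|≤m

module _ {T : Tournament n} (semiacyclic : Semiacyclic T) where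

  semiacyclic⇒no-balanced-cycle : ∀ {L} → weight L ≡ 0ℤ → ¬ IsDirectedCycle T L
  semiacyclic⇒no-balanced-cycle {L} w≡0 cycle =
    semiacyclic (L , cycle , Equivalence.from (ascending⇔nonnegative {T = T} cycle) (ℤ.≤-reflexive (sym w≡0)))

  semiacyclic⇒forbidsC₀ : ForbidsC₀ T
  semiacyclic⇒forbidsC₀ a b c a<b b<c cycle =
    semiacyclic (_ , cycle , Equivalence.from (ascending⇔nonnegative {T = T} cycle)
      (subst (0ℤ ℤ.≤_) (sym (weight³ {x = a} {b} {c} (ascent?-< a<b) (ascent?-< b<c) (ascent?-> (Fin.<-trans a<b b<c))))
        (+≤+ z≤n)))

  semiacyclic⇒forbidsC₁₋₄ : ForbidsC₁₋₄ T
  semiacyclic⇒forbidsC₁₋₄ a b c d a<b b<c c<d =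
    semiacyclic⇒no-balanced-cycle (weight⁴ {x = a} {c} {b} {d} (ascent?-< a<c) (ascent?-> b<c) (ascent?-< b<d) (ascent?-> a<d)) ,
    semiacyclic⇒no-balanced-cycle (weight⁴ {x = a} {d} {b} {c} (ascent?-< a<d) (ascent?-> b<d) (ascent?-< b<c) (ascent?-> a<c)) ,
    semiacyclic⇒no-balanced-cycle (weight⁴ {x = a} {b} {d} {c} (ascent?-< a<b) (ascent?-< b<d) (ascent?-> c<d) (ascent?-> a<c)) ,
    semiacyclic⇒no-balanced-cycle (weight⁴ {x = a} {c} {d} {b} (ascent?-< a<c) (ascent?-< c<d) (ascent?-> b<d) (ascent?-> a<b))
    where
    a<c = Fin.<-trans a<b b<c
    b<d = Fin.<-trans b<c c<d
    a<d = Fin.<-trans a<b b<d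

theorem8p6 : (n : ℕ) (T : Tournament n) →
    Semiacyclic T ⇔
      ((∀ (a b c : Fin n) → a < b → b < c →
          ¬ IsDirectedCycle T (a ∷ b ∷ c ∷ [])) ×
       (∀ (a b c d : Fin n) → a < b → b < c → c < d →
          ¬ IsDirectedCycle T (a ∷ c ∷ b ∷ d ∷ []) ×
          ¬ IsDirectedCycle T (a ∷ d ∷ b ∷ c ∷ []) ×
          ¬ IsDirectedCycle T (a ∷ b ∷ d ∷ c ∷ []) ×
          ¬ IsDirectedCycle T (a ∷ c ∷ d ∷ b ∷ [])))
theorem8p6 n T = mk⇔
  (λ semiacyclic → semiacyclic⇒forbidsC₀ {T = T} semiacyclic , semiacyclic⇒forbidsC₁₋₄ {T = T} semiacyclic)
  (λ (forbids₀ , forbids₁₋₄) (L , cycle , L-ascending) →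
     no-ascending-cycle-below {T = T} forbids₀ forbids₁₋₄ (suc (length L)) L ℕ.≤-refl cycle
       (Equivalence.to (ascending⇔nonnegative {T = T} cycle) L-ascending))
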